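{- Let $X$ be a finite set, $r\ge 3$, and $\tau\subseteq\binom{X}{r}$ non-empty. If $\tau$ is slim, then $\tau$ is thin. Moreover, for $r=3$, $\tau$ is thin if and only if $\tau$ is slim.
   Context: $L(\tau)=\bigcup_{s\in\tau}s$. $\tau\subseteq\binom{X}{r}$ is thin if $|L(\tau')|-|\tau'|-(r-1)\ge 0$ for every non-empty $\tau'\subseteq\tau$. A non-empty collection $\tau$ of subsets of $X$ each of size at least 3 is slim if $|L(\tau')|-2-\sum_{s\in\tau'}(|s|-2)\ge 0$ for every non-empty $\tau'\subseteq\tau$. -}

module Defs where

open import Data.Nat using (ℕ; _+_; _∸_; _≤_)
open import Data.List using (List; []; foldr; map; length)
open import Data.Nat.ListAction using (sum)
open import Data.List.Relation.Unary.All using (All)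
open import Data.List.Relation.Binary.Sublist.Propositional using (_⊆_)
open import Data.Fin.Subset using (Subset; _∪_; ⊥; ∣_∣)
open import Data.Product using (_×_)
open import Relation.Binary.PropositionalEquality using (_≢_)

-- The ground set X is Fin n; a subset of X is a Subset n.
-- A collection τ of subsets is a duplicate-free list (uniqueness is imposed
-- in the statement); sub-collections τ' ⊆ τ are sublists of τ.

L : ∀ {n} → List (Subset n) → Subset n
L = foldr _∪_ ⊥

-- τ (all of whose members have size r) is thin:
-- |L(τ')| - |τ'| - (r-1) ≥ 0 for every non-empty τ' ⊆ τ,
-- written in ℕ as |τ'| + (r ∸ 1) ≤ |L(τ')|  (r ≥ 3 in the statement).
Thin : ∀ {n} → ℕ → List (Subset n) → Set
Thin r τ = ∀ τ' → τ' ⊆ τ → τ' ≢ [] → length τ' + (r ∸ 1) ≤ ∣ L τ' ∣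

-- τ is slim: non-empty, every member has size ≥ 3, and
-- |L(τ')| - 2 - Σ_{s∈τ'} (|s| - 2) ≥ 0 for every non-empty τ' ⊆ τ,
-- written in ℕ as 2 + Σ (|s| ∸ 2) ≤ |L(τ')|  (|s| ≥ 3 so ∸ is exact).
Slim : ∀ {n} → List (Subset n) → Set
Slim τ = (τ ≢ []) × All (λ s → 3 ≤ ∣ s ∣) τ ×
  (∀ τ' → τ' ⊆ τ → τ' ≢ [] → 2 + sum (map (λ s → ∣ s ∣ ∸ 2) τ') ≤ ∣ L τ' ∣)

-- Every member of τ has exactly r elements, so Σ_{s∈τ'} (|s| − 2) = |τ'|(r − 2) and the slim
-- bound reads |L(τ')| ≥ 2 + k(r − 2) with k = |τ'| ≥ 1. Since k(r − 2) ≥ k + r − 3 whenever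
-- k ≥ 1 and r ≥ 3, this dominates the thin bound k + r − 1; for r = 3 the two bounds coincide.
module Submission where

open import Defs
open import Data.Nat using (ℕ; suc; _+_; _*_; _∸_; _≤_; s≤s; z≤n)
open import Data.Nat.Properties using (+-comm; *-identityʳ; m≤m*n; +-monoʳ-≤; ≤-reflexive; module ≤-Reasoning)
open import Data.Nat.ListAction using (sum)
open import Data.List using (List; []; _∷_; map; length)
open import Data.List.Relation.Unary.All as All using (All; []; _∷_)
open import Data.List.Relation.Unary.Unique.Propositional using (Unique)
open import Data.List.Relation.Binary.Sublist.Propositional using (_⊆_)
open import Data.List.Relation.Binary.Sublist.Propositional.Properties using (All-resp-⊆)
open import Data.Fin.Subset using (Subset; ∣_∣)
open import Data.Product using (_×_; _,_)
open import Function using (_∘_)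
open import Function.Bundles using (_⇔_; mk⇔)
open import Relation.Binary.PropositionalEquality using (_≡_; _≢_; refl; sym; cong; cong₂)

sum-map-const : ∀ {A : Set} {f : A → ℕ} {c : ℕ} {xs : List A} →
  All (λ x → f x ≡ c) xs → sum (map f xs) ≡ length xs * c
sum-map-const []         = refl
sum-map-const (fx≡c ∷ p) = cong₂ _+_ fx≡c (sum-map-const p)

Uniform : ∀ {n} → ℕ → List (Subset n) → Set
Uniform r τ = All (λ s → ∣ s ∣ ≡ r) τ

slim-sum-uniform : ∀ {n} {r} {τ : List (Subset n)} → Uniform r τ →
  sum (map (λ s → ∣ s ∣ ∸ 2) τ) ≡ length τ * (r ∸ 2)
slim-sum-uniform = sum-map-const ∘ All.map (cong (_∸ 2))

thin-bound≤slim-bound : ∀ k r → 1 ≤ k → 3 ≤ r → k + (r ∸ 1) ≤ 2 + k * (r ∸ 2)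
thin-bound≤slim-bound (suc j) (suc (suc (suc m))) (s≤s z≤n) (s≤s (s≤s (s≤s _))) = begin
  suc j + suc (suc m)        ≡⟨ cong suc (+-comm j (suc (suc m))) ⟩
  2 + (suc m + j)            ≤⟨ +-monoʳ-≤ (2 + suc m) (m≤m*n j (suc m)) ⟩
  2 + (suc m + j * suc m)    ∎
  where open ≤-Reasoning

≢[]⇒1≤length : ∀ {A : Set} {xs : List A} → xs ≢ [] → 1 ≤ length xs
≢[]⇒1≤length {xs = []}    xs≢[] with () ← xs≢[] refl
≢[]⇒1≤length {xs = _ ∷ _} _ = s≤s z≤n

slim⇒thin : ∀ {n} r → 3 ≤ r → (τ : List (Subset n)) → Uniform r τ → Slim τ → Thin r τ
slim⇒thin r 3≤r τ uniform (_ , _ , slim) τ' τ'⊆τ τ'≢[] = begin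
  length τ' + (r ∸ 1)                      ≤⟨ thin-bound≤slim-bound (length τ') r (≢[]⇒1≤length τ'≢[]) 3≤r ⟩
  2 + length τ' * (r ∸ 2)                  ≡⟨ cong (2 +_) (slim-sum-uniform (All-resp-⊆ τ'⊆τ uniform)) ⟨
  2 + sum (map (λ s → ∣ s ∣ ∸ 2) τ')       ≤⟨ slim τ' τ'⊆τ τ'≢[] ⟩
  ∣ L τ' ∣                                 ∎
  where open ≤-Reasoning

thin⇒slim : ∀ {n} (τ : List (Subset n)) → τ ≢ [] → Uniform 3 τ → Thin 3 τ → Slim τ
thin⇒slim τ τ≢[] uniform thin = τ≢[] , All.map (≤-reflexive ∘ sym) uniform , slim
  where
  slim : ∀ τ' → τ' ⊆ τ → τ' ≢ [] → 2 + sum (map (λ s → ∣ s ∣ ∸ 2) τ') ≤ ∣ L τ' ∣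
  slim τ' τ'⊆τ τ'≢[] = begin
    2 + sum (map (λ s → ∣ s ∣ ∸ 2) τ')     ≡⟨ cong (2 +_) (slim-sum-uniform (All-resp-⊆ τ'⊆τ uniform)) ⟩
    2 + length τ' * 1                      ≡⟨ cong (2 +_) (*-identityʳ (length τ')) ⟩
    2 + length τ'                          ≡⟨ +-comm 2 (length τ') ⟩
    length τ' + 2                          ≤⟨ thin τ' τ'⊆τ τ'≢[] ⟩
    ∣ L τ' ∣                               ∎
    where open ≤-Reasoning

lemma4 : (n r : ℕ) → 3 ≤ r → (τ : List (Subset n)) → Unique τ → τ ≢ [] →
    All (λ s → ∣ s ∣ ≡ r) τ →
    (Slim τ → Thin r τ) × (r ≡ 3 → (Thin r τ ⇔ Slim τ))
-- Both bounds only involve |τ'| and |L(τ')|.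
lemma4 n r 3≤r τ _ τ≢[] uniform =
  slim⇒thin r 3≤r τ uniform ,
  λ { refl → mk⇔ (thin⇒slim τ τ≢[] uniform) (slim⇒thin 3 3≤r τ uniform) }
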